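{- Suppose $G$ is a graph on $n \geq 2$ vertices, $s$ is an integer with $2 \leq s \leq n$, and $x_1,\dots,x_s$ are distinct vertices of $G$. Suppose $L$ is a list assignment for $G$ with $|L(v)| \geq n$ for each $v \in V(G)$, and suppose $L(x_1), \ldots, L(x_s)$ are pairwise disjoint. Then $$\big|\{f(V(G)): f \text{ is a proper } L\text{ -coloring of } G\}\big| \geq \prod_{i=1}^s|L(x_i)|.$$
   Context: All graphs are finite and simple. A list assignment $L$ for $G$ assigns to each vertex $v$ a set $L(v)$ of colors; a proper $L$-coloring is a proper coloring $f$ of $G$ with $f(v)\in L(v)$ for every vertex $v$. For a function $f$ and a set $A$ in its domain, $f(A)=\{f(a): a\in A\}$; so the left-hand side counts the distinct sets of colors used by proper $L$-colorings. -}

module Defs where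

open import Data.Nat using (ℕ)
open import Data.Fin using (Fin)
open import Data.List using (List)
open import Data.List.Membership.Propositional using (_∈_)
open import Data.List.Relation.Unary.Unique.Propositional using (Unique)
open import Data.Product using (Σ; ∃; _×_)
open import Relation.Binary.PropositionalEquality using (_≡_; _≢_)
open import Relation.Nullary using (¬_)
open import Level using (0ℓ; suc)

record Graph (n : ℕ) : Set₁ where
  field
    Adj   : Fin n → Fin n → Set
    sym   : ∀ {u v} → Adj u v → Adj v u
    irrefl : ∀ {v} → ¬ Adj v v
open Graph public

-- A list assignment: each vertex gets a finite set of colours (colours are ℕ),
-- represented as a duplicate-free list, so its length is the set's size.
record ListAssignment (n : ℕ) : Set where
  field
    list   : Fin n → List ℕ
    unique : ∀ v → Unique (list v)
open ListAssignment public

record IsProperLColoring {n : ℕ} (G : Graph n) (L : ListAssignment n)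
                         (f : Fin n → ℕ) : Set where
  field
    inList : ∀ v → f v ∈ list L v
    proper : ∀ {u v} → Adj G u v → f u ≢ f v

ProperLColoring : {n : ℕ} → Graph n → ListAssignment n → Set
ProperLColoring G L = Σ (Fin _ → ℕ) (IsProperLColoring G L)

Image : {n : ℕ} → (Fin n → ℕ) → ℕ → Set
Image f c = ∃ λ v → f v ≡ c

SameImage : {n : ℕ} → (Fin n → ℕ) → (Fin n → ℕ) → Set
SameImage f g = ∀ c → (Image f c → Image g c) × (Image g c → Image f c)

{-# OPTIONS --safe #-}
-- Colour injectively: an injective L-colouring is proper, and it is a transversal (system of
-- distinct representatives) of the lists. List the m = n − s vertices outside {x₁,…,xₛ}, with
-- lists W, followed by the xᵢ, with lists X; every list has at least m + 2 colours. By induction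
-- on m, the transversals of W ++ X realise at least ∏|Xᵢ| distinct colour sets. Fix a colour a
-- of the first list of W: transversals giving a to that vertex and transversals avoiding a
-- altogether have different colour sets. The first kind is counted by induction after deleting a
-- from every list; for the second the weaker bound ∏|Xᵢ| / (m + 1) suffices, and it holds for
-- lists one colour shorter by the same induction using the first kind only. Deleting a shrinks
-- at most one Xᵢ, as they are disjoint, so for lists of more than k colours it costs at most a
-- factor k / (k + 1), and the two bounds add up to ∏|Xᵢ|.
module Submission where

open import Data.Fin using (Fin; zero; suc)
import Data.Fin.Properties as Fin
open import Data.List using (List; []; _∷_; [_]; _++_; length; map; filter; allFin; lookup)
open import Data.List.Membership.Propositional using (_∈_; _∉_)
open import Data.List.Membership.Propositional.Properties
  using (∈-filter⁺; ∈-filter⁻; ∈-++⁺ˡ; ∈-++⁺ʳ; ∈-allFin; ∈-lookup)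
open import Data.List.Properties
  using (length-map; length-tabulate; length-++; map-++; map-∘; map-id-local; filter-all; filter-reject)
open import Data.List.Relation.Binary.Disjoint.Propositional using (Disjoint; contractₗ)
open import Data.List.Relation.Binary.Pointwise using (Pointwise; []; _∷_)
open import Data.List.Relation.Unary.All as All using (All; []; _∷_)
import Data.List.Relation.Unary.All.Properties as All
open import Data.List.Relation.Unary.AllPairs as AllPairs using (AllPairs; []; _∷_)
import Data.List.Relation.Unary.AllPairs.Properties as AllPairs
open import Data.List.Relation.Unary.Any using (here; there; any?)
open import Data.List.Relation.Unary.Unique.Propositional using (Unique)
import Data.List.Relation.Unary.Unique.Propositional.Properties as Unique
open import Data.Nat using (ℕ; zero; suc; _+_; _*_; _≤_; z≤n; s≤s)
open import Data.Nat.ListAction using (product)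
open import Data.Nat.Properties
open import Algebra.Properties.CommutativeSemigroup *-commutativeSemigroup using (x∙yz≈y∙xz)
open import Data.Product using (Σ; _×_; _,_; proj₁; proj₂; ∃-syntax; swap)
import Data.Product as Product
open import Function using (id; _∘_; _on_; flip)
open import Function.Definitions using (Injective)
open import Relation.Binary.Definitions using (DecidableEquality; Symmetric)
open import Relation.Binary.PropositionalEquality using (_≡_; _≢_; refl; trans; cong; cong₂; subst)
import Relation.Binary.PropositionalEquality as ≡
open import Relation.Nullary using (¬_; Dec; yes; no; ¬?; contradiction)

open import Defs

AllPairs-map-All : ∀ {A : Set} {P : A → Set} {R S : A → A → Set} {xs} →
                   (∀ {x y} → P x → R x y → S x y) → All P xs → AllPairs R xs → AllPairs S xs
AllPairs-map-All f []         []         = []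
AllPairs-map-All f (px ∷ pxs) (rx ∷ rxs) = All.map (f px) rx ∷ AllPairs-map-All f pxs rxs

AllPairs-lookup : ∀ {A : Set} {R : A → A → Set} {xs} → AllPairs R xs → Symmetric R →
                  ∀ i j → i ≢ j → R (lookup xs i) (lookup xs j)
AllPairs-lookup (_ ∷ _)   _     zero    zero    i≢j = contradiction refl i≢j
AllPairs-lookup (rx ∷ _)  _     zero    (suc j) _   = All.lookup rx (∈-lookup j)
AllPairs-lookup (rx ∷ _)  sym-R (suc i) zero    _   = sym-R (All.lookup rx (∈-lookup i))
AllPairs-lookup (_ ∷ rxs) sym-R (suc i) (suc j) i≢j = AllPairs-lookup rxs sym-R i j (i≢j ∘ cong suc)

∈-tail : ∀ {A : Set} {u v : A} {us} → v ∈ u ∷ us → u ≢ v → v ∈ us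
∈-tail (here v≡u) u≢v = contradiction (≡.sym v≡u) u≢v
∈-tail (there v∈) _   = v∈

map-proj₁-toList : ∀ {A : Set} {P : A → Set} {xs} (pxs : All P xs) → map proj₁ (All.toList pxs) ≡ xs
map-proj₁-toList []         = refl
map-proj₁-toList (_ ∷ pxs) = cong (_ ∷_) (map-proj₁-toList pxs)

lookup-injective : ∀ {A : Set} {xs : List A} → Unique xs → Injective _≡_ _≡_ (lookup xs)
lookup-injective (_ ∷ _)   {zero}  {zero}  _  = refl
lookup-injective (x≢ ∷ _)  {zero}  {suc j} eq = contradiction eq (All.lookup x≢ (∈-lookup j))
lookup-injective (x≢ ∷ _)  {suc i} {zero}  eq = contradiction (≡.sym eq) (All.lookup x≢ (∈-lookup i))
lookup-injective (_ ∷ xs!) {suc i} {suc j} eq = cong suc (lookup-injective xs! eq)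

Unique⇒length≤ : ∀ {n} {vs : List (Fin n)} → Unique vs → length vs ≤ n
Unique⇒length≤ vs! = Fin.injective⇒≤ (lookup-injective vs!)

ratio-*ˡ : ∀ k z {x y} → k * x ≤ suc k * y → k * (z * x) ≤ suc k * (z * y)
ratio-*ˡ k z {x} {y} kx≤k′y = begin
  k * (z * x)      ≡⟨ x∙yz≈y∙xz k z x ⟩
  z * (k * x)      ≤⟨ *-monoʳ-≤ z kx≤k′y ⟩
  z * (suc k * y)  ≡⟨ x∙yz≈y∙xz z (suc k) y ⟩
  suc k * (z * y)  ∎
  where open ≤-Reasoning

ratio-*ʳ : ∀ k z {x y} → k * x ≤ suc k * y → k * (x * z) ≤ suc k * (y * z)
ratio-*ʳ k z {x} {y} kx≤k′y = begin
  k * (x * z)      ≡⟨ *-assoc k x z ⟨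
  k * x * z        ≤⟨ *-monoˡ-≤ z kx≤k′y ⟩
  suc k * y * z    ≡⟨ *-assoc (suc k) y z ⟩
  suc k * (y * z)  ∎
  where open ≤-Reasoning

module Transversals {C : Set} (_≟_ : DecidableEquality C) where

  private
    _≢?_ : ∀ a b → Dec (a ≢ b)
    a ≢? b = ¬? (a ≟ b)

  _∖_ : List C → C → List C
  l ∖ a = filter (a ≢?_) l

  ∈-∖⁻ : ∀ {a c} l → c ∈ l ∖ a → c ∈ l × a ≢ c
  ∈-∖⁻ {a} l = ∈-filter⁻ (a ≢?_) {xs = l}

  ∖-fresh : ∀ {a} l → a ∉ l → l ∖ a ≡ l
  ∖-fresh {a} l a∉l = filter-all (a ≢?_) (All.¬Any⇒All¬ l a∉l)

  ∖-head : ∀ {a} l → All (a ≢_) l → (a ∷ l) ∖ a ≡ l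
  ∖-head {a} l a≢l =
    trans (filter-reject (a ≢?_) (λ a≢a → a≢a refl)) (∖-fresh l (All.All¬⇒¬Any a≢l))

  length-∖ : ∀ a {l} → Unique l → length l ≤ suc (length (l ∖ a))
  length-∖ a {[]}    _           = z≤n
  length-∖ a {b ∷ l} (b≢l ∷ l!) with a ≟ b
  ... | yes refl rewrite ∖-fresh l (All.All¬⇒¬Any b≢l) = ≤-refl
  ... | no  _    = s≤s (length-∖ a l!)

  AtLeastDistinct : ℕ → List C → Set
  AtLeastDistinct k l = Unique l × k ≤ length l

  AtLeastDistinct-∖ : ∀ {k} a {l} → AtLeastDistinct (suc k) l → AtLeastDistinct k (l ∖ a)
  AtLeastDistinct-∖ a (l! , k<l) = Unique.filter⁺ (a ≢?_) l! , ≤-pred (≤-trans k<l (length-∖ a l!))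

  *-length-∖ : ∀ {k} a {l} → AtLeastDistinct (suc k) l → k * length l ≤ suc k * length (l ∖ a)
  *-length-∖ {k} a {l} big = begin
    k * length l                       ≤⟨ *-monoʳ-≤ k (length-∖ a (proj₁ big)) ⟩
    k * suc (length (l ∖ a))           ≡⟨ *-suc k _ ⟩
    k + k * length (l ∖ a)             ≤⟨ +-monoˡ-≤ _ (proj₂ (AtLeastDistinct-∖ a big)) ⟩
    length (l ∖ a) + k * length (l ∖ a) ∎
    where open ≤-Reasoning

  All-∖ : ∀ {k} a {Ls} → All (AtLeastDistinct (suc k)) Ls → All (AtLeastDistinct k) (map (_∖ a) Ls)
  All-∖ a big = All.map⁺ (All.map (AtLeastDistinct-∖ a) big)

  Disjoint-∖ : ∀ a {X} → AllPairs Disjoint X → AllPairs Disjoint (map (_∖ a) X)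
  Disjoint-∖ a X# =
    AllPairs.map⁺ (AllPairs.map (λ {A} {B} A#B {_} (p , q) → A#B (proj₁ (∈-∖⁻ A p) , proj₁ (∈-∖⁻ B q))) X#)

  ∏length : List (List C) → ℕ
  ∏length Ls = product (map length Ls)

  ∏length-∖ : ∀ k a {X} → All (AtLeastDistinct (suc k)) X → AllPairs Disjoint X →
              k * ∏length X ≤ suc k * ∏length (map (_∖ a) X)
  ∏length-∖ k a {[]}    []         []         = *-monoˡ-≤ 1 (n≤1+n k)
  ∏length-∖ k a {A ∷ R} (bigA ∷ bigR) (A#R ∷ R#) with any? (a ≟_) A
  ... | yes a∈A rewrite map-id-local (All.map (λ {B} A#B → ∖-fresh B (λ a∈B → A#B (a∈A , a∈B))) A#R) =
          ratio-*ʳ k (∏length R) (*-length-∖ a bigA)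
  ... | no  a∉A rewrite ∖-fresh A a∉A = ratio-*ˡ k (length A) (∏length-∖ k a bigR R#)

  infix 4 _⊈_
  _⊈_ : List C → List C → Set
  c ⊈ d = ∃[ z ] z ∈ c × z ∉ d

  ∷-⊈ : ∀ {a c d} → a ∉ c → c ⊈ d → a ∷ c ⊈ a ∷ d
  ∷-⊈ a∉c (z , z∈c , z∉d) =
    z , there z∈c , λ { (here refl) → a∉c z∈c ; (there z∈d) → z∉d z∈d }

  IsTransversal : List (List C) → List C → Set
  IsTransversal Ls c = Pointwise _∈_ c Ls × Unique c

  SeparatedTransversals : List (List C) → List (List C) → Set
  SeparatedTransversals Ls F = All (IsTransversal Ls) F × AllPairs _⊈_ F

  Pointwise-∖⁻ : ∀ {a c} Ls → Pointwise _∈_ c (map (_∖ a) Ls) → Pointwise _∈_ c Ls × All (a ≢_) c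
  Pointwise-∖⁻ []       []       = [] , []
  Pointwise-∖⁻ (l ∷ Ls) (c∈ ∷ cs∈) = Product.zip _∷_ _∷_ (∈-∖⁻ l c∈) (Pointwise-∖⁻ Ls cs∈)

  module _ {a : C} where

    weaken : ∀ {Ls c} → IsTransversal (map (_∖ a) Ls) c → IsTransversal Ls c
    weaken {Ls} (c∈ , c!) = proj₁ (Pointwise-∖⁻ Ls c∈) , c!

    avoids : ∀ {Ls c} → IsTransversal (map (_∖ a) Ls) c → a ∉ c
    avoids {Ls} (c∈ , _) = All.All¬⇒¬Any (proj₂ (Pointwise-∖⁻ Ls c∈))

    extend : ∀ {l Ls c} → a ∈ l → IsTransversal (map (_∖ a) Ls) c → IsTransversal (l ∷ Ls) (a ∷ c)
    extend {Ls = Ls} a∈l (c∈ , c!) =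
      let (c∈′ , a≢c) = Pointwise-∖⁻ Ls c∈ in a∈l ∷ c∈′ , a≢c ∷ c!

    extendAll : ∀ {l Ls F} → a ∈ l → SeparatedTransversals (map (_∖ a) Ls) F →
                SeparatedTransversals (l ∷ Ls) (map (a ∷_) F)
    extendAll a∈l (ts , F⊈) =
      All.map⁺ (All.map (extend a∈l) ts) ,
      AllPairs.map⁺ (AllPairs-map-All (∷-⊈ ∘ avoids) ts F⊈)

    merge : ∀ {l Ls F₁ F₂} → a ∈ l →
            SeparatedTransversals (map (_∖ a) Ls) F₁ →
            SeparatedTransversals (map (_∖ a) (l ∷ Ls)) F₂ →
            SeparatedTransversals (l ∷ Ls) (map (a ∷_) F₁ ++ F₂)
    merge {l} {Ls} {F₁} a∈l S₁ (ts₂ , F₂⊈) =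
      let (ts₁ , F₁⊈) = extendAll a∈l S₁
          a∉F₂ = All.map (avoids {Ls = l ∷ Ls}) ts₂
      in All.++⁺ ts₁ (All.map weaken ts₂) ,
         AllPairs.++⁺ F₁⊈ F₂⊈
           (All.map⁺ (All.universal (λ _ → All.map (λ a∉d → a , here refl , a∉d) a∉F₂) F₁))

  length-merge : ∀ a (F₁ F₂ : List (List C)) → length (map (a ∷_) F₁ ++ F₂) ≡ length F₁ + length F₂
  length-merge a F₁ F₂ =
    trans (length-++ (map (a ∷_) F₁)) (cong (_+ length F₂) (length-map (a ∷_) F₁))

  SeparatedTransversals-∖-++ : ∀ a W X {F} → SeparatedTransversals (map (_∖ a) W ++ map (_∖ a) X) F →
                               SeparatedTransversals (map (_∖ a) (W ++ X)) F
  SeparatedTransversals-∖-++ a W X = subst (flip SeparatedTransversals _) (≡.sym (map-++ (_∖ a) W X))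

  prepend : ∀ {R F} A → Unique A → All (Disjoint A) R → SeparatedTransversals R F →
            ∃[ F′ ] SeparatedTransversals (A ∷ R) F′ × length F′ ≡ length A * length F
  prepend []      _           _   _ = [] , ([] , []) , refl
  prepend {R} {F} (a ∷ A) (a≢A ∷ A!) A#R S =
    let (F′ , S′ , |F′|) = prepend A A! (All.map contractₗ A#R) S in
    map (a ∷_) F ++ F′ ,
    merge (here refl)
      (subst (flip SeparatedTransversals F) (≡.sym R∖a≡R) S)
      (subst (flip SeparatedTransversals F′) (≡.sym (cong₂ _∷_ (∖-head A a≢A) R∖a≡R)) S′) ,
    trans (length-merge a F F′) (cong (length F +_) |F′|)
    where
      R∖a≡R : map (_∖ a) R ≡ R
      R∖a≡R = map-id-local (All.map (λ {B} A#B → ∖-fresh B (λ a∈B → A#B (here refl , a∈B))) A#R)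

  separatedTransversals-disjoint : ∀ X → All Unique X → AllPairs Disjoint X →
                                   ∃[ F ] SeparatedTransversals X F × ∏length X ≤ length F
  separatedTransversals-disjoint []      []         []         = [ [] ] , (([] , []) ∷ [] , [] ∷ []) , ≤-refl
  separatedTransversals-disjoint (A ∷ R) (A! ∷ R!) (A#R ∷ R#) =
    let (F , S , ∏R≤F) = separatedTransversals-disjoint R R! R#
        (F′ , S′ , |F′|) = prepend A A! A#R S
    in F′ , S′ , ≤-trans (*-monoʳ-≤ (length A) ∏R≤F) (≤-reflexive (≡.sym |F′|))

  separatedTransversals-tight : ∀ m W X → length W ≡ m →
    All (AtLeastDistinct m) W → All (AtLeastDistinct (suc m)) X → AllPairs Disjoint X →
    ∃[ F ] SeparatedTransversals (W ++ X) F × ∏length X ≤ suc m * length F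
  separatedTransversals-tight zero [] X _ _ bigX X# =
    let (F , S , ∏X≤F) = separatedTransversals-disjoint X (All.map proj₁ bigX) X#
    in F , S , ≤-trans ∏X≤F (m≤m+n (length F) 0)
  separatedTransversals-tight (suc m) ((a ∷ l) ∷ W) X refl (_ ∷ bigW) bigX X# =
    let X′ = map (_∖ a) X
        (F , S , ∏X′≤F) = separatedTransversals-tight m (map (_∖ a) W) X′ (length-map (_∖ a) W)
                            (All-∖ a bigW) (All-∖ a bigX) (Disjoint-∖ a X#)
    in map (a ∷_) F ,
       extendAll (here refl) (SeparatedTransversals-∖-++ a W X S) ,
       *-cancelˡ-≤ (suc m) (begin
         suc m * ∏length X                              ≤⟨ ∏length-∖ (suc m) a bigX X# ⟩
         suc (suc m) * ∏length X′                       ≤⟨ *-monoʳ-≤ (suc (suc m)) ∏X′≤F ⟩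
         suc (suc m) * (suc m * length F)               ≡⟨ x∙yz≈y∙xz (suc (suc m)) (suc m) (length F) ⟩
         suc m * (suc (suc m) * length F)               ≡⟨ cong ((suc m *_) ∘ (suc (suc m) *_))
                                                                 (length-map (a ∷_) F) ⟨
         suc m * (suc (suc m) * length (map (a ∷_) F))  ∎)
    where open ≤-Reasoning

  separatedTransversals : ∀ m W X → length W ≡ m →
    All (AtLeastDistinct (suc m)) W → All (AtLeastDistinct (2 + m)) X → AllPairs Disjoint X →
    ∃[ F ] SeparatedTransversals (W ++ X) F × ∏length X ≤ length F
  separatedTransversals zero [] X _ _ bigX X# = separatedTransversals-disjoint X (All.map proj₁ bigX) X#
  separatedTransversals (suc m) (l@(a ∷ _) ∷ W) X refl (bigl ∷ bigW) bigX X# =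
    let X′ = map (_∖ a) X
        (F₁ , S₁ , ∏X′≤F₁) = separatedTransversals m (map (_∖ a) W) X′ (length-map (_∖ a) W)
                               (All-∖ a bigW) (All-∖ a bigX) (Disjoint-∖ a X#)
        (F₂ , S₂ , ∏X′≤F₂) = separatedTransversals-tight (suc m) (map (_∖ a) (l ∷ W)) X′
                               (length-map (_∖ a) (l ∷ W)) (All-∖ a (bigl ∷ bigW)) (All-∖ a bigX) (Disjoint-∖ a X#)
        q = 2 + m
    in map (a ∷_) F₁ ++ F₂ ,
       merge (here refl) (SeparatedTransversals-∖-++ a W X S₁) (SeparatedTransversals-∖-++ a (l ∷ W) X S₂) ,
       *-cancelˡ-≤ q (begin
         q * ∏length X                    ≤⟨ ∏length-∖ q a bigX X# ⟩
         ∏length X′ + q * ∏length X′      ≤⟨ +-mono-≤ ∏X′≤F₂ (*-monoʳ-≤ q ∏X′≤F₁) ⟩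
         q * length F₂ + q * length F₁    ≡⟨ +-comm (q * length F₂) (q * length F₁) ⟩
         q * length F₁ + q * length F₂    ≡⟨ *-distribˡ-+ q (length F₁) (length F₂) ⟨
         q * (length F₁ + length F₂)      ≡⟨ cong (q *_) (length-merge a F₁ F₂) ⟨
         q * length (map (a ∷_) F₁ ++ F₂) ∎)
    where open ≤-Reasoning

module ColourAt {V : Set} (_≟ᵥ_ : DecidableEquality V) where

  colourAt : List V → List ℕ → V → ℕ
  colourAt (u ∷ us) (c ∷ cs) v with u ≟ᵥ v
  ... | yes _ = c
  ... | no  _ = colourAt us cs v
  colourAt _ _ _ = 0

  colourAt-head : ∀ {u us c cs} → colourAt (u ∷ us) (c ∷ cs) u ≡ c
  colourAt-head {u} with u ≟ᵥ u
  ... | yes _   = refl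
  ... | no  u≢u = contradiction refl u≢u

  colourAt-tail : ∀ {u us c cs v} → u ≢ v → colourAt (u ∷ us) (c ∷ cs) v ≡ colourAt us cs v
  colourAt-tail {u} {v = v} u≢v with u ≟ᵥ v
  ... | yes u≡v = contradiction u≡v u≢v
  ... | no  _   = refl

  module _ {Lf : V → List ℕ} where

    colourAt-∈-list : ∀ {us cs v} → Pointwise _∈_ cs (map Lf us) → v ∈ us → colourAt us cs v ∈ Lf v
    colourAt-∈-list {u ∷ us} {c ∷ cs} {v} (c∈ ∷ cs∈) v∈ with u ≟ᵥ v
    ... | yes refl = c∈
    ... | no  u≢v  = colourAt-∈-list cs∈ (∈-tail v∈ u≢v)

    colourAt-∈ : ∀ {us cs v} → Pointwise _∈_ cs (map Lf us) → v ∈ us → colourAt us cs v ∈ cs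
    colourAt-∈ {u ∷ us} {c ∷ cs} {v} (_ ∷ cs∈) v∈ with u ≟ᵥ v
    ... | yes _   = here refl
    ... | no  u≢v = there (colourAt-∈ cs∈ (∈-tail v∈ u≢v))

    colourAt-onto : ∀ {us cs z} → Pointwise _∈_ cs (map Lf us) → Unique us → z ∈ cs →
                    ∃[ v ] v ∈ us × colourAt us cs v ≡ z
    colourAt-onto {u ∷ us} (_ ∷ _) _ (here refl) = u , here refl , colourAt-head
    colourAt-onto {u ∷ us} (_ ∷ cs∈) (u≢us ∷ us!) (there z∈) =
      let (v , v∈ , cv≡z) = colourAt-onto cs∈ us! z∈
      in v , there v∈ , trans (colourAt-tail (All.lookup u≢us v∈)) cv≡z

    colourAt-injective : ∀ {us cs u v} → Pointwise _∈_ cs (map Lf us) → Unique cs →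
                         u ∈ us → v ∈ us → u ≢ v → colourAt us cs u ≢ colourAt us cs v
    colourAt-injective {w ∷ us} {c ∷ cs} {u} {v} (_ ∷ cs∈) (c≢cs ∷ cs!) u∈ v∈ u≢v with w ≟ᵥ u | w ≟ᵥ v
    ... | yes refl | yes refl = contradiction refl u≢v
    ... | yes refl | no  w≢v  = All.lookup c≢cs (colourAt-∈ cs∈ (∈-tail v∈ w≢v))
    ... | no  w≢u  | yes refl = All.lookup c≢cs (colourAt-∈ cs∈ (∈-tail u∈ w≢u)) ∘ ≡.sym
    ... | no  w≢u  | no  w≢v  = colourAt-injective cs∈ cs! (∈-tail u∈ w≢u) (∈-tail v∈ w≢v) u≢v

SameImage-sym : ∀ {n} {f g : Fin n → ℕ} → SameImage f g → SameImage g f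
SameImage-sym f≈g c = swap (f≈g c)

module FromTransversals {n} (G : Graph n) (L : ListAssignment n)
                        {vs : List (Fin n)} (vs! : Unique vs) (vs-complete : ∀ v → v ∈ vs) where
  open Transversals Data.Nat._≟_
  open ColourAt (Fin._≟_ {n})

  colouring : ∀ {c} → IsTransversal (map (list L) vs) c → ProperLColoring G L
  colouring {c} (c∈ , c!) = colourAt vs c , record
    { inList = λ v → colourAt-∈-list c∈ (vs-complete v)
    ; proper = λ {u} {v} uv →
        colourAt-injective c∈ c! (vs-complete u) (vs-complete v) (λ { refl → irrefl G uv })
    }

  ⊈⇒¬SameImage : ∀ {c d} → IsTransversal (map (list L) vs) c → IsTransversal (map (list L) vs) d →
                 c ⊈ d → ¬ SameImage (colourAt vs c) (colourAt vs d)
  ⊈⇒¬SameImage {d = d} (c∈ , _) (d∈ , _) (z , z∈c , z∉d) same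
    with v , _ , cv≡z ← colourAt-onto c∈ vs! z∈c
    with w , dw≡z ← proj₁ (same z) (v , cv≡z)
    = z∉d (subst (_∈ d) dw≡z (colourAt-∈ d∈ (vs-complete w)))

  colourings : ∀ {F} → SeparatedTransversals (map (list L) vs) F →
               Σ (List (ProperLColoring G L)) λ fs →
                 (∀ i j → i ≢ j → ¬ SameImage (proj₁ (lookup fs i)) (proj₁ (lookup fs j))) ×
                 length fs ≡ length F
  colourings {F} (ts , F⊈) = fs , AllPairs-lookup fs≉ (_∘ SameImage-sym) , |fs|≡|F|
    where
      T = All.toList ts
      fs = map (colouring ∘ proj₂) T

      T⊈ : AllPairs (_⊈_ on proj₁) T
      T⊈ = AllPairs.map⁻ (subst (AllPairs _⊈_) (≡.sym (map-proj₁-toList ts)) F⊈)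

      fs≉ : AllPairs (λ f g → ¬ SameImage (proj₁ f) (proj₁ g)) fs
      fs≉ = AllPairs.map⁺ (AllPairs.map (λ {t} {t′} → ⊈⇒¬SameImage (proj₂ t) (proj₂ t′)) T⊈)

      |fs|≡|F| : length fs ≡ length F
      |fs|≡|F| = begin
        length fs            ≡⟨ length-map (colouring ∘ proj₂) T ⟩
        length T             ≡⟨ length-map proj₁ T ⟨
        length (map proj₁ T) ≡⟨ cong length (map-proj₁-toList ts) ⟩
        length F             ∎
        where open ≡.≡-Reasoning

module _ {n : ℕ} (xs : List (Fin n)) where

  private
    ∉xs? : ∀ v → Dec (v ∉ xs)
    ∉xs? v = ¬? (any? (v Fin.≟_) xs)

  complement : List (Fin n)
  complement = filter ∉xs? (allFin n)

  complement-++-Unique : Unique xs → Unique (complement ++ xs)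
  complement-++-Unique xs! = Unique.++⁺ (Unique.filter⁺ ∉xs? (Unique.allFin⁺ n)) xs!
    (λ (v∈ , v∈xs) → proj₂ (∈-filter⁻ ∉xs? {xs = allFin n} v∈) v∈xs)

  length-complement : Unique xs → length complement + length xs ≤ n
  length-complement xs! = subst (_≤ n) (length-++ complement) (Unique⇒length≤ (complement-++-Unique xs!))

  complement-++-complete : ∀ v → v ∈ complement ++ xs
  complement-++-complete v with any? (v Fin.≟_) xs
  ... | yes v∈xs = ∈-++⁺ʳ complement v∈xs
  ... | no  v∉xs = ∈-++⁺ˡ (∈-filter⁺ ∉xs? (∈-allFin v) v∉xs)

open Transversals Data.Nat._≟_

lemma20 : (n : ℕ) → 2 ≤ n → (G : Graph n) → (s : ℕ) → 2 ≤ s → s ≤ n →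
          (x : Fin s → Fin n) → Injective _≡_ _≡_ x →
          (L : ListAssignment n) → (∀ v → n ≤ length (list L v)) →
          (∀ i j → i ≢ j → ∀ c → c ∈ list L (x i) → ¬ (c ∈ list L (x j))) →
          Σ (List (ProperLColoring G L)) λ fs →
            (∀ i j → i ≢ j →
               ¬ SameImage (proj₁ (lookup fs i)) (proj₁ (lookup fs j))) ×
            (product (map (λ i → length (list L (x i))) (allFin s)) ≤ length fs)
-- The hypotheses 2 ≤ n and s ≤ n follow from 2 ≤ s and the injectivity of x.
lemma20 n _ G s 2≤s _ x x-inj L n≤|L| L# =
  let (F , S , ∏X≤F) = separatedTransversals m W X (length-map (list L) ws)
                         (large (<⇒≤ 2+m≤n) ws) (large 2+m≤n xs) X#
      (fs , fs≉ , |fs|≡|F|) = colourings (subst (flip SeparatedTransversals F) (≡.sym (map-++ (list L) ws xs)) S)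
  in fs , fs≉ , (begin
       product (map (λ i → length (list L (x i))) (allFin s)) ≡⟨ cong product (trans (map-∘ _) (map-∘ xs)) ⟩
       ∏length X                                              ≤⟨ ∏X≤F ⟩
       length F                                               ≡⟨ |fs|≡|F| ⟨
       length fs                                              ∎)
  where
    open ≤-Reasoning
    xs = map x (allFin s)
    xs! = Unique.map⁺ x-inj (Unique.allFin⁺ s)
    ws = complement xs
    m = length ws
    W = map (list L) ws
    X = map (list L) xs
    open FromTransversals G L (complement-++-Unique xs xs!) (complement-++-complete xs)

    2+m≤n : 2 + m ≤ n
    2+m≤n = begin
      2 + m         ≤⟨ +-monoˡ-≤ m 2≤s ⟩
      s + m         ≡⟨ +-comm s m ⟩
      m + s         ≡⟨ cong (m +_) (trans (length-map x (allFin s)) (length-tabulate id)) ⟨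
      m + length xs ≤⟨ length-complement xs xs! ⟩
      n             ∎

    large : ∀ {k} → k ≤ n → ∀ us → All (AtLeastDistinct k) (map (list L) us)
    large k≤n us = All.map⁺ (All.universal (λ v → unique L v , ≤-trans k≤n (n≤|L| v)) us)

    X# : AllPairs Disjoint X
    X# = AllPairs.map⁺ (AllPairs.map⁺ (AllPairs.tabulate⁺ (λ i≢j (c∈ , c∈′) → L# _ _ i≢j _ c∈ c∈′)))
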